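{- Let $\mathbb{K}$ be any field, $n\ge 1$, and $G=UU_n(\mathbb{K})$. Let $x=(x_{ij})\in G$ satisfy $\prod_{i=1}^{n-1}x_{i,i+1}\neq 0$. Then the centralizer $C_G(x)$ is abelian.
   Context: $UU_n(\mathbb{K})$ is the group of $n\times n$ upper triangular matrices over $\mathbb{K}$ with all diagonal entries equal to $1$. -}

module Defs where

open import Level using (Level; _⊔_) renaming (suc to lsuc)
open import Data.Nat using (ℕ; zero; suc)
open import Data.Fin using (Fin; toℕ; inject₁) renaming (zero to fzero; suc to fsuc)
open import Data.Nat as ℕ using ()
open import Data.Product using (Σ; _×_)
open import Relation.Nullary using (¬_)
open import Algebra.Bundles using (CommutativeRing)

record Field (c ℓ : Level) : Set (lsuc (c ⊔ ℓ)) where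
  field
    commutativeRing : CommutativeRing c ℓ
  open CommutativeRing commutativeRing public
  field
    0≉1     : ¬ (0# ≈ 1#)
    inverse : ∀ x → ¬ (x ≈ 0#) → Σ Carrier (λ y → (x * y) ≈ 1#)

module MatrixDefs {c ℓ : Level} (K : Field c ℓ) where
  open Field K

  Mat : ℕ → Set c
  Mat n = Fin n → Fin n → Carrier

  sumFin : ∀ {n} → (Fin n → Carrier) → Carrier
  sumFin {zero}  f = 0#
  sumFin {suc n} f = f fzero + sumFin (λ k → f (fsuc k))

  _·_ : ∀ {n} → Mat n → Mat n → Mat n
  (A · B) i j = sumFin (λ k → A i k * B k j)

  _≈M_ : ∀ {n} → Mat n → Mat n → Set ℓ
  A ≈M B = ∀ i j → A i j ≈ B i j

  record IsUnitriangular {n} (A : Mat n) : Set ℓ where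
    field
      below : ∀ i j → toℕ j ℕ.< toℕ i → A i j ≈ 0#
      diag  : ∀ i → A i i ≈ 1#

  -- product of superdiagonal entries  ∏_{i=1}^{n-1} A_{i,i+1}
  -- (indices 0-based: ∏_{i=0}^{n-2} A (inject₁ i) (suc i)); empty product = 1
  superdiagProd : ∀ {n} → Mat n → Carrier
  superdiagProd {zero}        A = 1#
  superdiagProd {suc zero}    A = 1#
  superdiagProd {suc (suc n)} A =
    A fzero (fsuc fzero) * superdiagProd {suc n} (λ i j → A (fsuc i) (fsuc j))

-- Write x = I + N with N = x - I strictly upper triangular; ∏ x_{i,i+1} ≠ 0
-- says that N is regular (all superdiagonal entries nonzero), and y commutes
-- with x iff it commutes with N.  The centralizer of a regular nilpotent N
-- consists of polynomials in N, which we use in peeled form: if R commutes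
-- with N and vanishes below its k-th superdiagonal, then comparing entries of
-- N R and R N gives N_{i,i+1} R_{i+1,i+k+1} = R_{i,i+k} N_{i+k,i+k+1}, so the
-- k-th diagonal of R vanishes once its first entry does; since the first entry
-- of the k-th diagonal of N^k is a product of superdiagonal entries, hence
-- nonzero, R - c N^k vanishes below the (k+1)-th superdiagonal for suitable c.
-- Induction on n - k, using that the centralizer of N contains every c N^k,
-- shows that any two upper triangular matrices commuting with N commute.
module Submission where

open import Defs
open import Level using (Level; _⊔_)
open import Data.Nat as ℕ using (ℕ; zero; suc; _≥_; _<_)
import Data.Nat.Properties as ℕP
open import Data.Fin using (Fin; toℕ; pred; fromℕ<; _≟_)
  renaming (zero to fzero; suc to fsuc)
import Data.Fin.Properties as FinP
open import Data.Product using (_×_; _,_; ∃-syntax)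
open import Relation.Nullary using (¬_; yes; no; contradiction)
open import Relation.Binary.Definitions using (tri<; tri≈; tri>)
open import Relation.Binary.PropositionalEquality as ≡ using (_≡_; _≢_)
open import Relation.Binary.Bundles using (Setoid)
import Relation.Binary.Reasoning.Setoid as SetoidReasoning

OnDiag : ∀ {n} → ℕ → Fin n → Fin n → Set
OnDiag k i j = toℕ j ≡ k ℕ.+ toℕ i

toℕ-pred : ∀ {n} (j : Fin n) → toℕ (pred j) ≡ ℕ.pred (toℕ j)
toℕ-pred fzero    = ≡.refl
toℕ-pred (fsuc j) = FinP.toℕ-inject₁ j

pred-height : ∀ {n m} (j : Fin n) → toℕ j ≡ suc m → toℕ (pred j) ≡ m
pred-height j e = ≡.trans (toℕ-pred j) (≡.cong ℕ.pred e)

pred-superdiag : ∀ {n m} (j : Fin n) → toℕ j ≡ suc m → OnDiag 1 (pred j) j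
pred-superdiag j e = ≡.trans e (≡.cong suc (≡.sym (pred-height j e)))

module Scalars {c ℓ : Level} (K : Field c ℓ) where
  open Field K
  open import Algebra.Properties.Ring ring using (-‿distribˡ-*)
  open import Algebra.Properties.CommutativeSemigroup *-commutativeSemigroup
    using (x∙yz≈y∙xz)
  open SetoidReasoning setoid

  nonzero-cancel : ∀ {a b} → ¬ a ≈ 0# → a * b ≈ 0# → b ≈ 0#
  nonzero-cancel {a} {b} a≉0 ab≈0 with inverse a a≉0
  ... | a⁻¹ , aa⁻¹≈1 = begin
    b               ≈⟨ sym (*-identityˡ b) ⟩
    1# * b          ≈⟨ *-congʳ (sym aa⁻¹≈1) ⟩
    (a * a⁻¹) * b   ≈⟨ *-congʳ (*-comm a a⁻¹) ⟩
    (a⁻¹ * a) * b   ≈⟨ *-assoc a⁻¹ a b ⟩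
    a⁻¹ * (a * b)   ≈⟨ *-congˡ ab≈0 ⟩
    a⁻¹ * 0#        ≈⟨ zeroʳ a⁻¹ ⟩
    0#              ∎

  nonzero-* : ∀ {a b} → ¬ a ≈ 0# → ¬ b ≈ 0# → ¬ (a * b) ≈ 0#
  nonzero-* a≉0 b≉0 ab≈0 = b≉0 (nonzero-cancel a≉0 ab≈0)

  sub-self : ∀ {a b} → a ≈ b → a + (- 1#) * b ≈ 0#
  sub-self {a} {b} a≈b = begin
    a + (- 1#) * b  ≈⟨ +-cong a≈b (sym (-‿distribˡ-* 1# b)) ⟩
    b + - (1# * b)  ≈⟨ +-congˡ (-‿cong (*-identityˡ b)) ⟩
    b + - b         ≈⟨ -‿inverseʳ b ⟩
    0#              ∎

  sub-add : ∀ a b c' → (a + (- c') * b) + c' * b ≈ a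
  sub-add a b c' = begin
    (a + (- c') * b) + c' * b  ≈⟨ +-assoc a _ _ ⟩
    a + ((- c') * b + c' * b)  ≈⟨ +-congˡ (sym (distribʳ b (- c') c')) ⟩
    a + (- c' + c') * b        ≈⟨ +-congˡ (*-congʳ (-‿inverseˡ c')) ⟩
    a + 0# * b                 ≈⟨ +-congˡ (zeroˡ b) ⟩
    a + 0#                     ≈⟨ +-identityʳ a ⟩
    a                          ∎

  cancel-with-inverse : ∀ r e v → e * v ≈ 1# → r + (- (r * v)) * e ≈ 0#
  cancel-with-inverse r e v ev≈1 = begin
    r + (- (r * v)) * e  ≈⟨ +-congˡ (sym (-‿distribˡ-* (r * v) e)) ⟩
    r + - ((r * v) * e)  ≈⟨ +-congˡ (-‿cong rve≈r) ⟩
    r + - r              ≈⟨ -‿inverseʳ r ⟩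
    0#                   ∎
    where
    rve≈r : (r * v) * e ≈ r
    rve≈r = begin
      (r * v) * e  ≈⟨ *-assoc r v e ⟩
      r * (v * e)  ≈⟨ *-congˡ (*-comm v e) ⟩
      r * (e * v)  ≈⟨ *-congˡ ev≈1 ⟩
      r * 1#       ≈⟨ *-identityʳ r ⟩
      r            ∎

  scalar-swap : ∀ x c' y → x * (c' * y) ≈ c' * (x * y)
  scalar-swap = x∙yz≈y∙xz

module Sums {c ℓ : Level} (K : Field c ℓ) where
  open Field K
  open MatrixDefs K
  open import Algebra.Properties.CommutativeSemigroup +-commutativeSemigroup
    using (interchange)
  open SetoidReasoning setoid

  sum-cong : ∀ {n} {f g : Fin n → Carrier} → (∀ k → f k ≈ g k) → sumFin f ≈ sumFin g
  sum-cong {zero}  f≈g = refl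
  sum-cong {suc n} f≈g = +-cong (f≈g fzero) (sum-cong (λ k → f≈g (fsuc k)))

  sum-zero : ∀ {n} (f : Fin n → Carrier) → (∀ k → f k ≈ 0#) → sumFin f ≈ 0#
  sum-zero {zero}  f f≈0 = refl
  sum-zero {suc n} f f≈0 =
    trans (+-cong (f≈0 fzero) (sum-zero _ (λ k → f≈0 (fsuc k)))) (+-identityˡ 0#)

  sum-single : ∀ {n} (f : Fin n → Carrier) (l : Fin n) →
               (∀ k → k ≢ l → f k ≈ 0#) → sumFin f ≈ f l
  sum-single {suc n} f fzero f≈0 =
    trans (+-congˡ (sum-zero _ (λ k → f≈0 (fsuc k) λ ()))) (+-identityʳ _)
  sum-single {suc n} f (fsuc l) f≈0 =
    trans (+-cong (f≈0 fzero λ ()) (sum-single _ l λ k k≢l → f≈0 (fsuc k) (λ e → k≢l (FinP.suc-injective e))))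
          (+-identityˡ _)

  sum-+ : ∀ {n} (f g : Fin n → Carrier) →
          sumFin (λ k → f k + g k) ≈ sumFin f + sumFin g
  sum-+ {zero}  f g = sym (+-identityˡ 0#)
  sum-+ {suc n} f g = begin
    (f fzero + g fzero) + sumFin (λ k → f (fsuc k) + g (fsuc k))
      ≈⟨ +-congˡ (sum-+ (λ k → f (fsuc k)) (λ k → g (fsuc k))) ⟩
    (f fzero + g fzero) + (sumFin (λ k → f (fsuc k)) + sumFin (λ k → g (fsuc k)))
      ≈⟨ interchange _ _ _ _ ⟩
    sumFin f + sumFin g ∎

  sum-*ˡ : ∀ {n} (a : Carrier) (f : Fin n → Carrier) →
           sumFin (λ k → a * f k) ≈ a * sumFin f
  sum-*ˡ {zero}  a f = sym (zeroʳ a)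
  sum-*ˡ {suc n} a f =
    trans (+-congˡ (sum-*ˡ a (λ k → f (fsuc k)))) (sym (distribˡ a (f fzero) _))

  sum-*ʳ : ∀ {n} (a : Carrier) (f : Fin n → Carrier) →
           sumFin (λ k → f k * a) ≈ sumFin f * a
  sum-*ʳ a f = trans (sum-cong (λ k → *-comm (f k) a)) (trans (sum-*ˡ a f) (*-comm a _))

  sum-swap : ∀ {m n} (f : Fin m → Fin n → Carrier) →
             sumFin (λ i → sumFin (λ j → f i j)) ≈ sumFin (λ j → sumFin (λ i → f i j))
  sum-swap {zero}  {n} f = sym (sum-zero {n} _ (λ _ → refl))
  sum-swap {suc m} {n} f = begin
    sumFin (f fzero) + sumFin (λ i → sumFin (λ j → f (fsuc i) j))
      ≈⟨ +-congˡ (sum-swap (λ i j → f (fsuc i) j)) ⟩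
    sumFin (f fzero) + sumFin (λ j → sumFin (λ i → f (fsuc i) j))
      ≈⟨ sym (sum-+ (f fzero) (λ j → sumFin (λ i → f (fsuc i) j))) ⟩
    sumFin (λ j → f fzero j + sumFin (λ i → f (fsuc i) j)) ∎

module Matrices {c ℓ : Level} (K : Field c ℓ) (n : ℕ) where
  open Field K
  open MatrixDefs K
  open Sums K
  open Scalars K using (scalar-swap)

  ≈M-setoid : Setoid c ℓ
  ≈M-setoid = record
    { Carrier       = Mat n
    ; _≈_           = _≈M_
    ; isEquivalence = record
      { refl  = λ i j → refl
      ; sym   = λ A≈B i j → sym (A≈B i j)
      ; trans = λ A≈B B≈C i j → trans (A≈B i j) (B≈C i j)
      }
    }

  open Setoid ≈M-setoid public using () renaming (refl to ≈M-refl; sym to ≈M-sym)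
  module ≈M-Reasoning = SetoidReasoning ≈M-setoid

  I : Mat n
  I i j with i ≟ j
  ... | yes _ = 1#
  ... | no  _ = 0#

  I-diag : ∀ i → I i i ≈ 1#
  I-diag i with i ≟ i
  ... | yes _ = refl
  ... | no i≢i = contradiction ≡.refl i≢i

  I-off : ∀ i j → i ≢ j → I i j ≈ 0#
  I-off i j i≢j with i ≟ j
  ... | yes i≡j = contradiction i≡j i≢j
  ... | no  _   = refl

  _⊕[_]_ : Mat n → Carrier → Mat n → Mat n
  (A ⊕[ a ] B) i j = A i j + a * B i j

  _^_ : Mat n → ℕ → Mat n
  A ^ zero  = I
  A ^ suc k = (A ^ k) · A

  ·-congˡ : ∀ (A : Mat n) {B B′ : Mat n} → B ≈M B′ → (A · B) ≈M (A · B′)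
  ·-congˡ A B≈B′ i j = sum-cong (λ k → *-congˡ (B≈B′ k j))

  ·-congʳ : ∀ {A A′ : Mat n} (B : Mat n) → A ≈M A′ → (A · B) ≈M (A′ · B)
  ·-congʳ B A≈A′ i j = sum-cong (λ k → *-congʳ (A≈A′ i k))

  ·-assoc : ∀ (A B C : Mat n) → ((A · B) · C) ≈M (A · (B · C))
  ·-assoc A B C i j = begin
    sumFin (λ k → sumFin (λ l → A i l * B l k) * C k j)
      ≈⟨ sum-cong (λ k → sym (sum-*ʳ (C k j) (λ l → A i l * B l k))) ⟩
    sumFin (λ k → sumFin (λ l → (A i l * B l k) * C k j))
      ≈⟨ sum-swap (λ k l → (A i l * B l k) * C k j) ⟩
    sumFin (λ l → sumFin (λ k → (A i l * B l k) * C k j))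
      ≈⟨ sum-cong (λ l → trans (sum-cong (λ k → *-assoc (A i l) (B l k) (C k j)))
                               (sum-*ˡ (A i l) (λ k → B l k * C k j))) ⟩
    sumFin (λ l → A i l * sumFin (λ k → B l k * C k j)) ∎
    where open SetoidReasoning setoid

  ·-identityˡ : ∀ (A : Mat n) → (I · A) ≈M A
  ·-identityˡ A i j =
    trans (sum-single _ i (λ k k≢i → trans (*-congʳ (I-off i k (λ i≡k → k≢i (≡.sym i≡k))))
                                           (zeroˡ _)))
          (trans (*-congʳ (I-diag i)) (*-identityˡ _))

  ·-identityʳ : ∀ (A : Mat n) → (A · I) ≈M A
  ·-identityʳ A i j =
    trans (sum-single _ j (λ k k≢j → trans (*-congˡ (I-off k j k≢j)) (zeroʳ _)))
          (trans (*-congˡ (I-diag j)) (*-identityʳ _))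

  ·-distribˡ-⊕ : ∀ (S A B : Mat n) a → (S · (A ⊕[ a ] B)) ≈M ((S · A) ⊕[ a ] (S · B))
  ·-distribˡ-⊕ S A B a i j =
    trans (sum-cong (λ k → trans (distribˡ (S i k) (A k j) (a * B k j))
                                 (+-congˡ (scalar-swap (S i k) a (B k j)))))
          (trans (sum-+ (λ k → S i k * A k j) (λ k → a * (S i k * B k j)))
                 (+-congˡ (sum-*ˡ a (λ k → S i k * B k j))))

  ·-distribʳ-⊕ : ∀ (S A B : Mat n) a → ((A ⊕[ a ] B) · S) ≈M ((A · S) ⊕[ a ] (B · S))
  ·-distribʳ-⊕ S A B a i j =
    trans (sum-cong (λ k → trans (distribʳ (S k j) (A i k) (a * B i k))
                                 (+-congˡ (*-assoc a (B i k) (S k j)))))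
          (trans (sum-+ (λ k → A i k * S k j) (λ k → a * (B i k * S k j)))
                 (+-congˡ (sum-*ˡ a (λ k → B i k * S k j))))

  ⊕-cong : ∀ {A A′ B B′ : Mat n} a → A ≈M A′ → B ≈M B′ → (A ⊕[ a ] B) ≈M (A′ ⊕[ a ] B′)
  ⊕-cong a A≈A′ B≈B′ i j = +-cong (A≈A′ i j) (*-congˡ (B≈B′ i j))

  Commute : Mat n → Mat n → Set ℓ
  Commute A B = (A · B) ≈M (B · A)

  commute-sym : ∀ {A B} → Commute A B → Commute B A
  commute-sym = ≈M-sym

  commute-cong : ∀ {S A B} → A ≈M B → Commute S A → Commute S B
  commute-cong {S} {A} {B} A≈B SA≈AS = begin
    S · B ≈⟨ ·-congˡ S (≈M-sym A≈B) ⟩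
    S · A ≈⟨ SA≈AS ⟩
    A · S ≈⟨ ·-congʳ S A≈B ⟩
    B · S ∎
    where open ≈M-Reasoning

  commute-I : ∀ S → Commute S I
  commute-I S i j = trans (·-identityʳ S i j) (sym (·-identityˡ S i j))

  commute-⊕ : ∀ {S A B} a → Commute S A → Commute S B → Commute S (A ⊕[ a ] B)
  commute-⊕ {S} {A} {B} a SA≈AS SB≈BS = begin
    S · (A ⊕[ a ] B)           ≈⟨ ·-distribˡ-⊕ S A B a ⟩
    (S · A) ⊕[ a ] (S · B)     ≈⟨ ⊕-cong a SA≈AS SB≈BS ⟩
    (A · S) ⊕[ a ] (B · S)     ≈⟨ ≈M-sym (·-distribʳ-⊕ S A B a) ⟩
    (A ⊕[ a ] B) · S           ∎
    where open ≈M-Reasoning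

  commute-^ : ∀ {S A} → Commute S A → ∀ k → Commute S (A ^ k)
  commute-^ {S} {A} SA≈AS zero    = commute-I S
  commute-^ {S} {A} SA≈AS (suc k) = begin
    S · ((A ^ k) · A)    ≈⟨ ≈M-sym (·-assoc S (A ^ k) A) ⟩
    (S · (A ^ k)) · A    ≈⟨ ·-congʳ A (commute-^ SA≈AS k) ⟩
    ((A ^ k) · S) · A    ≈⟨ ·-assoc (A ^ k) S A ⟩
    (A ^ k) · (S · A)    ≈⟨ ·-congˡ (A ^ k) SA≈AS ⟩
    (A ^ k) · (A · S)    ≈⟨ ≈M-sym (·-assoc (A ^ k) A S) ⟩
    ((A ^ k) · A) · S    ∎
    where open ≈M-Reasoning

  zero-commute : ∀ {A} S → (∀ i j → A i j ≈ 0#) → Commute A S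
  zero-commute {A} S A≈0 i j =
    trans (sum-zero _ (λ l → trans (*-congʳ (A≈0 i l)) (zeroˡ (S l j))))
          (sym (sum-zero _ (λ l → trans (*-congˡ (A≈0 l j)) (zeroʳ (S i l)))))

module Bands {c ℓ : Level} (K : Field c ℓ) (n : ℕ) where
  open Field K
  open MatrixDefs K
  open Sums K
  open Matrices K n

  Band : ℕ → Mat n → Set ℓ
  Band k A = ∀ i j → toℕ j < k ℕ.+ toℕ i → A i j ≈ 0#

  band-I : Band 0 I
  band-I i j j<i = I-off i j (λ i≡j → ℕP.<-irrefl (≡.cong toℕ (≡.sym i≡j)) j<i)

  band-⊕ : ∀ {k A B} a → Band k A → Band k B → Band k (A ⊕[ a ] B)
  band-⊕ a bandA bandB i j j<k+i =
    trans (+-cong (bandA i j j<k+i) (trans (*-congˡ (bandB i j j<k+i)) (zeroʳ a)))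
          (+-identityˡ 0#)

  band-· : ∀ {k l A B} → Band k A → Band l B → Band (l ℕ.+ k) (A · B)
  band-· {k} {l} {A} {B} bandA bandB i j j<l+k+i = sum-zero _ term≈0
    where
    term≈0 : ∀ m → A i m * B m j ≈ 0#
    term≈0 m with toℕ m ℕP.<? k ℕ.+ toℕ i
    ... | yes m<k+i = trans (*-congʳ (bandA i m m<k+i)) (zeroˡ _)
    ... | no  m≮k+i = trans (*-congˡ (bandB m j j<l+m)) (zeroʳ _)
      where
      j<l+m : toℕ j < l ℕ.+ toℕ m
      j<l+m = ℕP.<-≤-trans (≡.subst (toℕ j <_) (ℕP.+-assoc l k (toℕ i)) j<l+k+i)
                           (ℕP.+-monoʳ-≤ l (ℕP.≮⇒≥ m≮k+i))

  band-^ : ∀ {A} → Band 1 A → ∀ k → Band k (A ^ k)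
  band-^ bandA zero    = band-I
  band-^ bandA (suc k) = band-· (band-^ bandA k) bandA

  leading-entry : ∀ {k l A B} → Band k A → Band l B → ∀ {i p j} →
                  OnDiag k i p → OnDiag l p j → (A · B) i j ≈ A i p * B p j
  leading-entry {k} {l} {A} {B} bandA bandB {i} {p} {j} p-on j-on =
    sum-single _ p term≈0
    where
    term≈0 : ∀ m → m ≢ p → A i m * B m j ≈ 0#
    term≈0 m m≢p with ℕP.<-cmp (toℕ m) (toℕ p)
    ... | tri< m<p _ _ =
      trans (*-congʳ (bandA i m (≡.subst (toℕ m <_) p-on m<p))) (zeroˡ _)
    ... | tri≈ _ m≡p _ = contradiction (FinP.toℕ-injective m≡p) m≢p
    ... | tri> _ _ p<m =
      trans (*-congˡ (bandB m j (≡.subst (_< l ℕ.+ toℕ m) (≡.sym j-on)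
                                         (ℕP.+-monoʳ-< l p<m))))
            (zeroʳ _)

  band-suc : ∀ {k A} → Band k A → (∀ i j → OnDiag k i j → A i j ≈ 0#) → Band (suc k) A
  band-suc {k} bandA diag≈0 i j j<1+k+i with ℕP.<-cmp (toℕ j) (k ℕ.+ toℕ i)
  ... | tri< j<k+i _ _ = bandA i j j<k+i
  ... | tri≈ _ j≡k+i _ = diag≈0 i j j≡k+i
  ... | tri> _ _ k+i<j = contradiction (ℕP.≤-pred j<1+k+i) (ℕP.<⇒≱ k+i<j)

  band-full : ∀ {A} → Band n A → ∀ i j → A i j ≈ 0#
  band-full bandA i j = bandA i j (ℕP.<-≤-trans (FinP.toℕ<n j) (ℕP.m≤m+n n (toℕ i)))

module RegularNilpotent {c ℓ : Level} (K : Field c ℓ) (n : ℕ) (N : MatrixDefs.Mat K n)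
  (N-band  : Bands.Band K n 1 N)
  (N-super : ∀ i j → OnDiag 1 i j → ¬ Field._≈_ K (N i j) (Field.0# K))
  where
  open Field K
  open MatrixDefs K
  open Scalars K
  open Matrices K n
  open Bands K n

  -- The k-th diagonal of N^k consists of products of k superdiagonal entries.
  power-leading : ∀ k {i p} → OnDiag k i p → ¬ (N ^ k) i p ≈ 0#
  power-leading zero {i} {p} p-on Iip≈0
    with FinP.toℕ-injective p-on
  ... | ≡.refl = 0≉1 (trans (sym Iip≈0) (I-diag i))
  power-leading (suc k) {i} {p} p-on Nᵏ⁺¹ip≈0 =
    nonzero-* (power-leading k q-on) (N-super _ _ p-over-q)
      (trans (sym (leading-entry (band-^ N-band k) N-band q-on p-over-q)) Nᵏ⁺¹ip≈0)
    where
    q-on : OnDiag k i (pred p)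
    q-on = pred-height p p-on
    p-over-q : OnDiag 1 (pred p) p
    p-over-q = pred-superdiag p p-on

  -- For R in band k commuting with N, compare the (i, p⁺) entries of N R and
  -- R N, where (i, p) and (i⁺, p⁺) are consecutive entries of the k-th diagonal.
  diagonal-relation : ∀ {k R} → Commute N R → Band k R → ∀ {i i⁺ p p⁺} →
                      OnDiag 1 i i⁺ → OnDiag k i⁺ p⁺ → OnDiag k i p → OnDiag 1 p p⁺ →
                      N i i⁺ * R i⁺ p⁺ ≈ R i p * N p p⁺
  diagonal-relation NR≈RN bandR {i} {p⁺ = p⁺} i⁺-on p⁺-on p-on p⁺-on′ =
    trans (sym (leading-entry N-band bandR i⁺-on p⁺-on))
          (trans (NR≈RN i p⁺) (leading-entry bandR N-band p-on p⁺-on′))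

  diagonal-zero : ∀ {k R} → Commute N R → Band k R →
                  (∀ i p → toℕ i ≡ 0 → OnDiag k i p → R i p ≈ 0#) →
                  ∀ t i p → toℕ i ≡ t → OnDiag k i p → R i p ≈ 0#
  diagonal-zero NR≈RN bandR start zero    i p i≡0 p-on = start i p i≡0 p-on
  diagonal-zero {k} {R} NR≈RN bandR start (suc t) i p i≡1+t p-on =
    nonzero-cancel (N-super _ _ i-on)
      (trans (diagonal-relation NR≈RN bandR i-on p-on below-on p-on′)
             (trans (*-congʳ (diagonal-zero NR≈RN bandR start t _ _ i′≡t below-on))
                    (zeroˡ _)))
    where
    i′≡t : toℕ (pred i) ≡ t
    i′≡t = pred-height i i≡1+t
    i-on : OnDiag 1 (pred i) i
    i-on = pred-superdiag i i≡1+t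
    p≡1+k+t : toℕ p ≡ suc (k ℕ.+ t)
    p≡1+k+t = ≡.trans p-on (≡.trans (≡.cong (k ℕ.+_) i≡1+t) (ℕP.+-suc k t))
    p-on′ : OnDiag 1 (pred p) p
    p-on′ = pred-superdiag p p≡1+k+t
    below-on : OnDiag k (pred i) (pred p)
    below-on = ≡.trans (pred-height p p≡1+k+t) (≡.cong (k ℕ.+_) (≡.sym i′≡t))

  -- The multiple is
  -- chosen to cancel the first entry (i₀, p₀) of the k-th diagonal.
  Peeled : ℕ → Mat n → Set (c ⊔ ℓ)
  Peeled k R = ∃[ a ] ∃[ R′ ] Commute N R′ × Band (suc k) R′ × R ≈M (R′ ⊕[ a ] (N ^ k))

  peel-at : ∀ {k R} (i₀ p₀ : Fin n) → toℕ i₀ ≡ 0 → OnDiag k i₀ p₀ →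
            Commute N R → Band k R → Peeled k R
  peel-at {k} {R} i₀ p₀ i₀≡0 p₀-on NR≈RN bandR
    with inverse ((N ^ k) i₀ p₀) (power-leading k p₀-on)
  ... | e⁻¹ , ee⁻¹≈1 = a , R′ , NR′≈R′N , band-suc bandR′ diag≈0 , R≈R′+aNᵏ
    where
    a  = R i₀ p₀ * e⁻¹
    R′ = R ⊕[ - a ] (N ^ k)
    NR′≈R′N : Commute N R′
    NR′≈R′N = commute-⊕ (- a) NR≈RN (commute-^ {N} ≈M-refl k)
    bandR′ : Band k R′
    bandR′ = band-⊕ (- a) bandR (band-^ N-band k)
    start : ∀ i p → toℕ i ≡ 0 → OnDiag k i p → R′ i p ≈ 0#
    start i p i≡0 p-on
      with FinP.toℕ-injective (≡.trans i≡0 (≡.sym i₀≡0))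
    ... | ≡.refl with FinP.toℕ-injective (≡.trans p-on (≡.sym p₀-on))
    ... | ≡.refl = cancel-with-inverse (R i₀ p₀) ((N ^ k) i₀ p₀) e⁻¹ ee⁻¹≈1
    diag≈0 : ∀ i p → OnDiag k i p → R′ i p ≈ 0#
    diag≈0 i p = diagonal-zero NR′≈R′N bandR′ start (toℕ i) i p ≡.refl
    R≈R′+aNᵏ : R ≈M (R′ ⊕[ a ] (N ^ k))
    R≈R′+aNᵏ i j = sym (sub-add (R i j) ((N ^ k) i j) a)

  peel : ∀ {k R} → k < n → Commute N R → Band k R → Peeled k R
  peel {k} k<n = peel-at i₀ p₀ i₀≡0 p₀-on
    where
    i₀ : Fin n
    i₀ = fromℕ< (ℕP.<-≤-trans (ℕ.s≤s ℕ.z≤n) k<n)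
    i₀≡0 : toℕ i₀ ≡ 0
    i₀≡0 = FinP.toℕ-fromℕ< _
    p₀ : Fin n
    p₀ = fromℕ< k<n
    p₀-on : OnDiag k i₀ p₀
    p₀-on = ≡.trans (FinP.toℕ-fromℕ< k<n)
                    (≡.trans (≡.sym (ℕP.+-identityʳ k)) (≡.cong (k ℕ.+_) (≡.sym i₀≡0)))

  -- Induction on the number t = n - k of diagonals still to peel off.
  band-centralizer : ∀ t k → t ℕ.+ k ≡ n → ∀ {R S} →
                     Band k R → Commute N R → Commute N S → Commute R S
  band-centralizer zero k k≡n {R} {S} bandR NR≈RN NS≈SN =
    zero-commute S (band-full (≡.subst (λ m → Band m R) k≡n bandR))
  band-centralizer (suc t) k 1+t+k≡n {R} {S} bandR NR≈RN NS≈SN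
    with peel (≡.subst (k <_) 1+t+k≡n (ℕ.s≤s (ℕP.m≤n+m k t))) NR≈RN bandR
  ... | a , R′ , NR′≈R′N , bandR′ , R≈R′+aNᵏ =
    commute-sym (commute-cong (≈M-sym R≈R′+aNᵏ)
      (commute-⊕ a (commute-sym R′S≈SR′) (commute-^ (commute-sym NS≈SN) k)))
    where
    R′S≈SR′ : Commute R′ S
    R′S≈SR′ = band-centralizer t (suc k) (≡.trans (ℕP.+-suc t k) 1+t+k≡n)
                bandR′ NR′≈R′N NS≈SN

  centralizer-commutative : ∀ {R S} → Band 0 R → Commute N R → Commute N S → Commute R S
  centralizer-commutative = band-centralizer n 0 (ℕP.+-identityʳ n)

superdiag-nonzero : ∀ {c ℓ} (K : Field c ℓ) {n} (x : MatrixDefs.Mat K n) →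
  ¬ Field._≈_ K (MatrixDefs.superdiagProd K x) (Field.0# K) →
  ∀ i j → OnDiag 1 i j → ¬ Field._≈_ K (x i j) (Field.0# K)
superdiag-nonzero K {suc zero}    x ∏≉0 fzero fzero ()
superdiag-nonzero K {suc (suc n)} x ∏≉0 fzero (fsuc fzero) j-on x₀₁≈0 =
  ∏≉0 (Field.trans K (Field.*-congʳ K x₀₁≈0) (Field.zeroˡ K _))
superdiag-nonzero K {suc (suc n)} x ∏≉0 (fsuc i) (fsuc j) j-on =
  superdiag-nonzero K (λ a b → x (fsuc a) (fsuc b))
    (λ rest≈0 → ∏≉0 (Field.trans K (Field.*-congˡ K rest≈0) (Field.zeroʳ K _)))
    i j (ℕP.suc-injective j-on)

module Unitriangular {c ℓ : Level} (K : Field c ℓ) (n : ℕ) (x : MatrixDefs.Mat K n)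
  (x-unitri : MatrixDefs.IsUnitriangular K x) where
  open Field K
  open MatrixDefs K
  open Scalars K
  open Matrices K n
  open Bands K n
  open IsUnitriangular x-unitri

  N : Mat n
  N = x ⊕[ - 1# ] I

  N-band : Band 1 N
  N-band i j j≤i with ℕP.<-cmp (toℕ j) (toℕ i)
  ... | tri< j<i _ _ = sub-self (trans (below i j j<i) (sym (I-off i j i≢j)))
    where
    i≢j : i ≢ j
    i≢j i≡j = ℕP.<⇒≢ j<i (≡.cong toℕ (≡.sym i≡j))
  ... | tri≈ _ j≡i _ rewrite FinP.toℕ-injective j≡i = sub-self (trans (diag i) (sym (I-diag i)))
  ... | tri> _ _ i<j = contradiction (ℕP.≤-pred j≤i) (ℕP.<⇒≱ i<j)

  N-off : ∀ i j → i ≢ j → N i j ≈ x i j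
  N-off i j i≢j = trans (+-congˡ (trans (*-congˡ (I-off i j i≢j)) (zeroʳ _))) (+-identityʳ _)

  commute-N : ∀ {y} → Commute x y → Commute N y
  commute-N xy≈yx = commute-sym (commute-⊕ (- 1#) (commute-sym xy≈yx) (commute-I _))

  N-super : ¬ superdiagProd x ≈ 0# → ∀ i j → OnDiag 1 i j → ¬ N i j ≈ 0#
  N-super ∏≉0 i j j-on Nij≈0 =
    superdiag-nonzero K x ∏≉0 i j j-on (trans (sym (N-off i j i≢j)) Nij≈0)
    where
    i≢j : i ≢ j
    i≢j i≡j = ℕP.1+n≢n (≡.trans (≡.sym j-on) (≡.cong toℕ (≡.sym i≡j)))

theorem11p1 : {c ℓ : Level} (K : Field c ℓ) (n : ℕ) → n ≥ 1 →
    let open Field K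
        open MatrixDefs K
    in (x : Mat n) → IsUnitriangular x → ¬ (superdiagProd x ≈ 0#) →
       (y z : Mat n) → IsUnitriangular y → IsUnitriangular z →
       (x · y) ≈M (y · x) → (x · z) ≈M (z · x) →
       (y · z) ≈M (z · y)
theorem11p1 K n _ x x-unitri ∏≉0 y z y-unitri z-unitri xy≈yx xz≈zx =
  centralizer-commutative (below y-unitri) (commute-N xy≈yx) (commute-N xz≈zx)
  where
  open MatrixDefs.IsUnitriangular using (below)
  open Unitriangular K n x x-unitri using (N; N-band; N-super; commute-N)
  open RegularNilpotent K n N N-band (N-super ∏≉0) using (centralizer-commutative)
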